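{- Let $D$ be a finite set, $R\subseteq D^n$, and $\rho:R\to\mathbb{Q}_+$ a weighted relation; let $w\mathbb{A}$ be the weighted structure on $D$ with the single weighted relation $\rho$, and let $\mathbb{D}$ be the digraph constructed from $\rho$ as described in the context. Then $w\mathbb{A}$ is a rigid core if and only if $\mathbb{D}$ is a rigid core.
   Context: A weighted relation $\rho:R\to\mathbb{Q}_+$ ($\mathbb{Q}_+$ the non-negative rationals) has underlying relation $R$. $w\mathbb{A}$ is a rigid core if the only map $g:D\to D$ with $g(\mathbf{r})\in R$ for all $\mathbf{r}\in R$ (applied componentwise) is the identity; a digraph is a rigid core if its only endomorphism is the identity. Construction of $\mathbb{D}$: a single edge is the path $\bullet\to\bullet$ and a zigzag is the oriented path $\bullet\to\bullet\leftarrow\bullet\to\bullet$. For $S\subseteq\{1,\dots,n\}$ and $1\le l\le n$ let $Q_{S,l}$ be a single edge if $l\in S$ and a zigzag if $l\notin S$, and let $Q_S$ be the oriented path obtained by concatenating (identifying the terminal vertex of each piece with the initial vertex of the next) a single edge, $Q_{S,1},\dots,Q_{S,n}$, and a single edge, in this order. $\mathbb{D}$ has vertex set $D\cup R$ together with new internal vertices: for each pair $(d,\mathbf{a})\in D\times R$, add a copy of the path $Q_{\{i: d=a_i\}}$ whose initial vertex is $d$ and whose terminal vertex is $\mathbf{a}$, all other vertices of these copies being new and pairwise distinct. -}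

module Defs where

open import Data.Nat using (ℕ; zero; suc; _∸_; _<?_)
open import Data.Fin using (Fin; toℕ; fromℕ<) renaming (_≟_ to _≟F_)
open import Data.Vec using (Vec)
import Data.Vec as Vec
open import Data.List using (List; []; _∷_; _++_; concatMap; allFin; length)
import Data.List as List
open import Data.Bool using (Bool; true; false; T; if_then_else_)
open import Data.Rational using (ℚ; 0ℚ; _≤_)
open import Relation.Nullary using (does; yes; no)
open import Relation.Binary.PropositionalEquality using (_≡_)

-- D = Fin m (a finite set), R ⊆ D^n given by its (decidable) characteristic function.
Tuple : ℕ → ℕ → Set
Tuple m n = Vec (Fin m) n

record WeightedRelation (m n : ℕ) : Set where
  field
    R      : Tuple m n → Bool
    ρ      : (a : Tuple m n) → T (R a) → ℚ
    ρ-nonneg : ∀ a (p : T (R a)) → 0ℚ ≤ ρ a p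

PreservesR : ∀ {m n} → (Tuple m n → Bool) → (Fin m → Fin m) → Set
PreservesR R g = ∀ a → T (R a) → T (R (Vec.map g a))

RigidCoreW : ∀ {m n} → WeightedRelation m n → Set
RigidCoreW {m} {n} w = ∀ (g : Fin m → Fin m) → PreservesR (WeightedRelation.R w) g → ∀ x → g x ≡ x

record Digraph : Set₁ where
  field
    V : Set
    E : V → V → Set

IsEndo : (G : Digraph) → (Digraph.V G → Digraph.V G) → Set
IsEndo G h = ∀ u v → Digraph.E G u v → Digraph.E G (h u) (h v)

RigidCoreG : Digraph → Set
RigidCoreG G = ∀ (h : Digraph.V G → Digraph.V G) → IsEndo G h → ∀ x → h x ≡ x

data Dir : Set where
  fwd bwd : Dir

-- Q_{S,l}: single edge if l ∈ S, zigzag → ← → otherwise.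
-- Here S = { l : d = a_l }.
piece : ∀ {m n} → Fin m → Tuple m n → Fin n → List Dir
piece d a l with Vec.lookup a l ≟F d
... | yes _ = fwd ∷ []
... | no  _ = fwd ∷ bwd ∷ fwd ∷ []

-- Q_S as the list of edge orientations: single edge, Q_{S,1}, …, Q_{S,n}, single edge.
pathQ : ∀ {m n} → Fin m → Tuple m n → List Dir
pathQ {n = n} d a = fwd ∷ (concatMap (piece d a) (allFin n) ++ (fwd ∷ []))

module Construction {m n : ℕ} (R : Tuple m n → Bool) where

  -- number of internal vertices of the copy of Q_S from d to a
  nInt : Fin m → Tuple m n → ℕ
  nInt d a = length (pathQ d a) ∸ 1

  data Vtx : Set where
    dom : Fin m → Vtx
    rel : (a : Tuple m n) → T (R a) → Vtx
    int : (d : Fin m) (a : Tuple m n) → T (R a) → Fin (nInt d a) → Vtx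

  -- the i-th vertex (i = 0 … length) of the copy of Q_S from d to a
  at : (d : Fin m) (a : Tuple m n) → T (R a) → ℕ → Vtx
  at d a p zero = dom d
  at d a p (suc i) with i <? nInt d a
  ... | yes lt = int d a p (fromℕ< lt)
  ... | no  _  = rel a p

  data Edge : Vtx → Vtx → Set where
    fwdE : ∀ d a (p : T (R a)) (j : Fin (length (pathQ d a))) →
           List.lookup (pathQ d a) j ≡ fwd →
           Edge (at d a p (toℕ j)) (at d a p (suc (toℕ j)))
    bwdE : ∀ d a (p : T (R a)) (j : Fin (length (pathQ d a))) →
           List.lookup (pathQ d a) j ≡ bwd →
           Edge (at d a p (suc (toℕ j))) (at d a p (toℕ j))

  𝔻 : Digraph
  𝔻 = record { V = Vtx ; E = Edge }

digraphOf : ∀ {m n} → WeightedRelation m n → Digraph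
digraphOf w = Construction.𝔻 (WeightedRelation.R w)

-- Only the relation R underlying ρ matters.  A map g preserving R induces an endomorphism
-- of 𝔻: the copy of Q_S from d to a goes onto the copy of Q_S′ from g d to g a, where
-- S ⊆ S′, folding every zigzag of Q_S that faces a single edge of Q_S′.  Conversely, grade
-- 𝔻 by levels (0 on D, n + 2 on R).  An endomorphism h shifts levels along each copy of Q_S
-- by a constant, which must be 0, so h maps D into D.  Interior vertices of the copies have
-- no edges besides those of their own path, so h maps Q_S from d to a into one copy of some
-- Q_S′ from h d to c, and this is only possible by the same folding, with S ⊆ S′.  Taking
-- d = a_l gives c_l = h a_l, so h restricted to D preserves R.

module Submission where

open import Defs
open import Data.Bool using (Bool; true; false; T; _≤_; f≤t; b≤b)
open import Data.Bool.Properties using (T-irrelevant; ≤-minimum; ≤-maximum)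
open import Data.Empty using (⊥; ⊥-elim)
open import Data.Fin using (Fin; toℕ; fromℕ<) renaming (_≟_ to _≟F_)
import Data.Fin as F
open import Data.Fin.Properties using (toℕ<n; toℕ-fromℕ<; fromℕ<-toℕ)
open import Data.List using (List; []; _∷_; _++_; length; concatMap; tabulate)
import Data.List as List
open import Data.List.Properties using (length-tabulate)
open import Data.List.Relation.Binary.Pointwise using (Pointwise; []; _∷_; tabulate⁺; tabulate⁻)
open import Data.Nat using (ℕ; zero; suc; _+_; _<_; _<?_; z≤n; s≤s)
  renaming (_≤_ to _≤ℕ_)
open import Data.Nat.Properties using (≤-refl; +-identityʳ; module ≤-Reasoning; +-suc; suc-injective; ≤-pred; <⇒≤; n≮n;
  m≤n⇒m<n∨m≡n; +-cancelʳ-≤; n≤0⇒n≡0)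
open import Data.Product using (Σ; ∃; _×_; _,_; proj₁; proj₂; map₁; map₂)
open import Data.Sum using (_⊎_; inj₁; inj₂; [_,_]′) renaming (map to map-⊎)
open import Data.Unit using (tt)
import Data.Vec as Vec
open import Data.Vec.Properties using (lookup-map; map-cong; map-id; tabulate∘lookup; tabulate-cong)
open import Function using (_∘_; id)
open import Function.Bundles using (_⇔_; mk⇔)
open import Relation.Nullary using (yes; no)
open import Relation.Nullary.Decidable using (isYes; toWitness; fromWitness)
open import Relation.Binary.PropositionalEquality

infix 4 _[_]≔_
data _[_]≔_ {A : Set} : List A → ℕ → A → Set where
  here  : ∀ {x xs} → (x ∷ xs) [ 0 ]≔ x
  there : ∀ {y xs i x} → xs [ i ]≔ x → (y ∷ xs) [ suc i ]≔ x

module _ {A : Set} where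

  ≔-functional : ∀ {xs : List A} {i x y} → xs [ i ]≔ x → xs [ i ]≔ y → x ≡ y
  ≔-functional here      here      = refl
  ≔-functional (there p) (there q) = ≔-functional p q

  there⁻¹ : ∀ {xs : List A} {y i x} → (y ∷ xs) [ suc i ]≔ x → xs [ i ]≔ x
  there⁻¹ (there p) = p

  ≔⇒< : ∀ {xs : List A} {i x} → xs [ i ]≔ x → i < length xs
  ≔⇒< here      = s≤s z≤n
  ≔⇒< (there p) = s≤s (≔⇒< p)

  <⇒≔ : ∀ {xs : List A} {i} → i < length xs → ∃ λ x → xs [ i ]≔ x
  <⇒≔ {x ∷ xs} {zero}  _         = x , here
  <⇒≔ {x ∷ xs} {suc i} (s≤s lt) = map₂ there (<⇒≔ lt)

  lookup⇒≔ : ∀ (xs : List A) (j : Fin (length xs)) → xs [ toℕ j ]≔ List.lookup xs j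
  lookup⇒≔ (x ∷ xs) F.zero    = here
  lookup⇒≔ (x ∷ xs) (F.suc j) = there (lookup⇒≔ xs j)

  ≔⇒lookup : ∀ {xs : List A} {i x} → xs [ i ]≔ x →
             Σ (Fin (length xs)) λ j → toℕ j ≡ i × List.lookup xs j ≡ x
  ≔⇒lookup here      = F.zero , refl , refl
  ≔⇒lookup (there p) with ≔⇒lookup p
  ... | j , refl , e = F.suc j , refl , e

module _ where
  open Digraph

  IsHom : (G H : Digraph) → (V G → V H) → Set
  IsHom G H f = ∀ u v → E G u v → E H (f u) (f v)

  Step : (G : Digraph) → Dir → V G → V G → Set
  Step G fwd u v = E G u v
  Step G bwd u v = E G v u

  IsWalk : (G : Digraph) → List Dir → (ℕ → V G) → Set
  IsWalk G W φ = ∀ {j x} → W [ j ]≔ x → Step G x (φ j) (φ (suc j))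

  infixr 5 _◂_
  _◂_ : {A : Set} → A → (ℕ → A) → ℕ → A
  (u ◂ φ) zero    = u
  (u ◂ φ) (suc i) = φ i

  module _ {G : Digraph} where

    walk-cons : ∀ {x W u φ} → Step G x u (φ 0) → IsWalk G W φ → IsWalk G (x ∷ W) (u ◂ φ)
    walk-cons s w here      = s
    walk-cons s w (there p) = w p

    walk-tail : ∀ {x W φ} → IsWalk G (x ∷ W) φ → IsWalk G W (φ ∘ suc)
    walk-tail w p = w (there p)

    walk-cong : ∀ {W φ ψ} → (∀ i → i ≤ℕ length W → φ i ≡ ψ i) → IsWalk G W φ → IsWalk G W ψ
    walk-cong φ≗ψ w {x = x} p = subst₂ (Step G x) (φ≗ψ _ (<⇒≤ lt)) (φ≗ψ _ lt) (w p)
      where lt = ≔⇒< p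

    module _ {H : Digraph} {f : V G → V H} (hom : IsHom G H f) where

      hom-step : ∀ x {u v} → Step G x u v → Step H x (f u) (f v)
      hom-step fwd = hom _ _
      hom-step bwd = hom _ _

      hom-walk : ∀ {W φ} → IsWalk G W φ → IsWalk H W (f ∘ φ)
      hom-walk w {x = x} p = hom-step x (w p)

-- A homomorphism into ℕ⃗ is a grading by levels.
ℕ⃗ : Digraph
ℕ⃗ = record { V = ℕ ; E = λ u v → v ≡ suc u }

suc-hom : IsHom ℕ⃗ ℕ⃗ suc
suc-hom _ _ = cong suc

walks-parallel : ∀ {W φ ψ} → IsWalk ℕ⃗ W φ → IsWalk ℕ⃗ W ψ →
                 ∀ i → i ≤ℕ length W → φ i + ψ 0 ≡ φ 0 + ψ i
walks-parallel wφ wψ zero _ = refl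
walks-parallel {W} {φ} {ψ} wφ wψ (suc i) lt with <⇒≔ {xs = W} lt
... | fwd , p = begin
  φ (suc i) + ψ 0     ≡⟨ cong (_+ ψ 0) (wφ p) ⟩
  suc (φ i + ψ 0)     ≡⟨ cong suc (walks-parallel wφ wψ i (<⇒≤ lt)) ⟩
  suc (φ 0 + ψ i)     ≡⟨ sym (+-suc (φ 0) (ψ i)) ⟩
  φ 0 + suc (ψ i)     ≡⟨ cong (φ 0 +_) (sym (wψ p)) ⟩
  φ 0 + ψ (suc i)     ∎
  where open ≡-Reasoning
... | bwd , p = suc-injective (begin
  suc (φ (suc i) + ψ 0)  ≡⟨ cong (_+ ψ 0) (sym (wφ p)) ⟩
  φ i + ψ 0              ≡⟨ walks-parallel wφ wψ i (<⇒≤ lt) ⟩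
  φ 0 + ψ i              ≡⟨ cong (φ 0 +_) (wψ p) ⟩
  φ 0 + suc (ψ (suc i))  ≡⟨ +-suc (φ 0) (ψ (suc i)) ⟩
  suc (φ 0 + ψ (suc i))  ∎)
  where open ≡-Reasoning

-- Paths with closed interior

record InteriorClosed (G : Digraph) (W : List Dir) (ψ : ℕ → Digraph.V G) : Set where
  open Digraph G
  field
    out-closed : ∀ {y v} → suc y < length W → E (ψ (suc y)) v →
                 (W [ suc y ]≔ fwd × v ≡ ψ (suc (suc y))) ⊎ (W [ y ]≔ bwd × v ≡ ψ y)
    in-closed  : ∀ {y v} → suc y < length W → E v (ψ (suc y)) →
                 (W [ y ]≔ fwd × v ≡ ψ y) ⊎ (W [ suc y ]≔ bwd × v ≡ ψ (suc (suc y)))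

module _ {G : Digraph} where
  open Digraph G
  open InteriorClosed

  private
    fwd≢bwd : ∀ {W : List Dir} {i} → W [ i ]≔ fwd → W [ i ]≔ bwd → ⊥
    fwd≢bwd p q with ≔-functional p q
    ... | ()

  interior-tail : ∀ {x W ψ} → InteriorClosed G (x ∷ W) ψ → InteriorClosed G W (ψ ∘ suc)
  interior-tail c .out-closed lt e =
    map-⊎ (map₁ there⁻¹) (map₁ there⁻¹) (c .out-closed (s≤s lt) e)
  interior-tail c .in-closed lt e =
    map-⊎ (map₁ there⁻¹) (map₁ there⁻¹) (c .in-closed (s≤s lt) e)

  module _ {W ψ} (c : InteriorClosed G W ψ) {y} (p : W [ y ]≔ fwd) where

    advance : ∀ {u v} → W [ suc y ]≔ fwd → u ≡ ψ (suc y) → E u v → v ≡ ψ (suc (suc y))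
    advance q refl e with c .out-closed (≔⇒< q) e
    ... | inj₁ (_ , v≡) = v≡
    ... | inj₂ (p′ , _) = ⊥-elim (fwd≢bwd p p′)

    retreat : ∀ {u v} → W [ suc y ]≔ fwd → v ≡ ψ (suc y) → E u v → u ≡ ψ y
    retreat q refl e with c .in-closed (≔⇒< q) e
    ... | inj₁ (_ , u≡) = u≡
    ... | inj₂ (q′ , _) = ⊥-elim (fwd≢bwd q q′)

    sink : ∀ {u v} → W [ suc y ]≔ bwd → u ≡ ψ (suc y) → E u v → ⊥
    sink q refl e with c .out-closed (≔⇒< q) e
    ... | inj₁ (q′ , _) = fwd≢bwd q′ q
    ... | inj₂ (p′ , _) = fwd≢bwd p p′

-- The oriented paths Q_S and their folding

-- A mask lists, for l = 1 … n, whether l ∈ S; Q_S is fwd ∷ segments mask.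
segments : List Bool → List Dir
segments []           = fwd ∷ []
segments (true ∷ bs)  = fwd ∷ segments bs
segments (false ∷ bs) = fwd ∷ bwd ∷ fwd ∷ segments bs

segments-head : ∀ bs → segments bs [ 0 ]≔ fwd
segments-head []          = here
segments-head (true ∷ _)  = here
segments-head (false ∷ _) = here

infix 4 _⊑_
_⊑_ : List Bool → List Bool → Set
_⊑_ = Pointwise _≤_

-- A zigzag facing a single edge folds onto it; all other pieces are copied.  The last
-- clause also covers positions past the end and S ⊈ S′, where the value is irrelevant.
collapse : List Bool → List Bool → ℕ → ℕ
collapse _            _             zero                = zero
collapse (true ∷ bs)  (true ∷ bs′)  (suc k)             = suc (collapse bs bs′ k)
collapse (false ∷ bs) (true ∷ bs′)  (suc zero)          = 1
collapse (false ∷ bs) (true ∷ bs′)  (suc (suc zero))    = 0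
collapse (false ∷ bs) (true ∷ bs′)  (suc (suc (suc k))) = suc (collapse bs bs′ k)
collapse (false ∷ bs) (false ∷ bs′) (suc (suc (suc k))) = suc (suc (suc (collapse bs bs′ k)))
collapse _            _             k                   = k

collapse-diagonal : ∀ bs i → collapse bs bs i ≡ i
collapse-diagonal _            zero                = refl
collapse-diagonal []           (suc i)             = refl
collapse-diagonal (true ∷ bs)  (suc i)             = cong suc (collapse-diagonal bs i)
collapse-diagonal (false ∷ bs) (suc zero)          = refl
collapse-diagonal (false ∷ bs) (suc (suc zero))    = refl
collapse-diagonal (false ∷ bs) (suc (suc (suc i))) = cong (suc ∘ suc ∘ suc) (collapse-diagonal bs i)

collapse-end : ∀ {bs bs′} → bs ⊑ bs′ → collapse bs bs′ (length (segments bs)) ≡ length (segments bs′)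
collapse-end []                             = refl
collapse-end {true ∷ _}  {true ∷ _}  (_ ∷ s) = cong suc (collapse-end s)
collapse-end {false ∷ _} {true ∷ _}  (_ ∷ s) = cong suc (collapse-end s)
collapse-end {false ∷ _} {false ∷ _} (_ ∷ s) = cong (suc ∘ suc ∘ suc) (collapse-end s)

collapse-bounded : ∀ {bs bs′} → bs ⊑ bs′ → ∀ i → i ≤ℕ length (segments bs) →
                   collapse bs bs′ i ≤ℕ length (segments bs′)
collapse-bounded _ zero _ = z≤n
collapse-bounded [] (suc i) le = le
collapse-bounded {true ∷ _}  {true ∷ _}  (_ ∷ s) (suc i) (s≤s le) = s≤s (collapse-bounded s i le)
collapse-bounded {false ∷ _} {true ∷ _}  (_ ∷ s) (suc zero) _ = s≤s z≤n
collapse-bounded {false ∷ _} {true ∷ _}  (_ ∷ s) (suc (suc zero)) _ = z≤n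
collapse-bounded {false ∷ _} {true ∷ _}  (_ ∷ s) (suc (suc (suc i))) (s≤s (s≤s (s≤s le))) =
  s≤s (collapse-bounded s i le)
collapse-bounded {false ∷ _} {false ∷ _} (_ ∷ s) (suc zero) _ = s≤s z≤n
collapse-bounded {false ∷ _} {false ∷ _} (_ ∷ s) (suc (suc zero)) _ = s≤s (s≤s z≤n)
collapse-bounded {false ∷ _} {false ∷ _} (_ ∷ s) (suc (suc (suc i))) (s≤s (s≤s (s≤s le))) =
  s≤s (s≤s (s≤s (collapse-bounded s i le)))

full : ℕ → List Bool
full k = tabulate {n = k} (λ _ → true)

identity-walk : ∀ k → IsWalk ℕ⃗ (fwd ∷ segments (full k)) id
identity-walk k       here                 = refl
identity-walk zero    (there here)         = refl
identity-walk zero    (there (there ()))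
identity-walk (suc k) {x = x} (there p)    = hom-step suc-hom x (identity-walk k p)

module _ {G : Digraph} where
  open Digraph G
  open InteriorClosed

  collapse-walk : ∀ {bs bs′ ψ} → bs ⊑ bs′ → IsWalk G (segments bs′) ψ →
                  IsWalk G (segments bs) (ψ ∘ collapse bs bs′)
  collapse-walk [] w here = w here
  collapse-walk {true ∷ _}  {true ∷ _}  (_ ∷ s) w here      = w here
  collapse-walk {true ∷ _}  {true ∷ _}  (_ ∷ s) w (there p) = collapse-walk s (walk-tail w) p
  collapse-walk {false ∷ _} {true ∷ _}  (_ ∷ s) w here                      = w here
  collapse-walk {false ∷ _} {true ∷ _}  (_ ∷ s) w (there here)              = w here
  collapse-walk {false ∷ _} {true ∷ _}  (_ ∷ s) w (there (there here))      = w here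
  collapse-walk {false ∷ _} {true ∷ _}  (_ ∷ s) w (there (there (there p))) =
    collapse-walk s (walk-tail w) p
  collapse-walk {false ∷ _} {false ∷ _} (_ ∷ s) w here                      = w here
  collapse-walk {false ∷ _} {false ∷ _} (_ ∷ s) w (there here)              = w (there here)
  collapse-walk {false ∷ _} {false ∷ _} (_ ∷ s) w (there (there here))      = w (there (there here))
  collapse-walk {false ∷ _} {false ∷ _} (_ ∷ s) w (there (there (there p))) =
    collapse-walk s (walk-tail (walk-tail (walk-tail w))) p

  -- Piece by piece, φ starts where ψ does; a single edge facing a zigzag would end in
  -- its sink, which the next forward edge of φ cannot leave.
  collapse-forced : ∀ {bs bs′ φ ψ} → length bs ≡ length bs′ →
    InteriorClosed G (fwd ∷ segments bs′) ψ → IsWalk G (segments bs) φ → φ 0 ≡ ψ 1 →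
    bs ⊑ bs′ × (∀ i → i ≤ℕ length (segments bs) → φ i ≡ ψ (suc (collapse bs bs′ i)))
  collapse-forced {[]} {[]} {φ} _ c w φ0 = [] , λ where
      zero _              → φ0
      (suc zero) _        → φ1
      (suc (suc _)) (s≤s ())
    where φ1 = advance c here (there here) φ0 (w here)
  collapse-forced {true ∷ bs} {true ∷ bs′} {φ} {ψ} len c w φ0 = b≤b ∷ s , λ where
      zero _          → φ0
      (suc i) (s≤s le) → φ≗ i le
    where
      φ1 = advance c here (there here) φ0 (w here)
      rest = collapse-forced (suc-injective len) (interior-tail c) (walk-tail w) φ1
      s = proj₁ rest
      φ≗ = proj₂ rest
  collapse-forced {true ∷ bs} {false ∷ bs′} {φ} _ c w φ0 =
    ⊥-elim (sink c (there here) (there (there here)) φ1 (w (there (segments-head bs))))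
    where φ1 = advance c here (there here) φ0 (w here)
  collapse-forced {false ∷ bs} {true ∷ bs′} {φ} {ψ} len c w φ0 = f≤t ∷ s , λ where
      zero _                   → φ0
      (suc zero) _             → φ1
      (suc (suc zero)) _       → φ2
      (suc (suc (suc i))) (s≤s (s≤s (s≤s le))) → φ≗ i le
    where
      φ1 = advance c here (there here) φ0 (w here)
      φ2 = retreat c (there here) (there (there (segments-head bs′))) φ1 (w (there here))
      φ3 = advance c here (there here) φ2 (w (there (there here)))
      rest = collapse-forced (suc-injective len) (interior-tail c) (walk-tail (walk-tail (walk-tail w))) φ3
      s = proj₁ rest
      φ≗ = proj₂ rest
  collapse-forced {false ∷ bs} {false ∷ bs′} {φ} {ψ} len c w φ0 = b≤b ∷ s , λ where
      zero _                   → φ0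
      (suc zero) _             → φ1
      (suc (suc zero)) _       → φ2
      (suc (suc (suc i))) (s≤s (s≤s (s≤s le))) → φ≗ i le
    where
      φ1 = advance c here (there here) φ0 (w here)
      -- ψ 2 is a sink of Q_S′, while φ 3 has an out-edge.
      φ3≢ψ2 : φ 3 ≡ ψ 2 → ⊥
      φ3≢ψ2 e = sink c (there here) (there (there here)) e (w (there (there (there (segments-head bs)))))
      φ2 : φ 2 ≡ ψ 3
      φ2 with c .in-closed (≔⇒< {xs = fwd ∷ segments (false ∷ bs′)} (there (there here)))
                           (subst (E (φ 2)) φ1 (w (there here)))
      ... | inj₂ (_ , e) = e
      ... | inj₁ (_ , e) = ⊥-elim (φ3≢ψ2 (advance c here (there here) e (w (there (there here)))))
      φ3 : φ 3 ≡ ψ 4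
      φ3 with c .out-closed (≔⇒< {xs = fwd ∷ segments (false ∷ bs′)} (there (there (there here))))
                            (subst (λ u → E u (φ 3)) φ2 (w (there (there here))))
      ... | inj₁ (_ , e) = e
      ... | inj₂ (_ , e) = ⊥-elim (φ3≢ψ2 e)
      rest = collapse-forced (suc-injective len)
               (interior-tail (interior-tail (interior-tail c)))
               (walk-tail (walk-tail (walk-tail w))) φ3
      s = proj₁ rest
      φ≗ = proj₂ rest

≤⇒T→T : ∀ {b b′} → b ≤ b′ → T b → T b′
≤⇒T→T b≤b t = t
≤⇒T→T f≤t ()

T→T⇒≤ : ∀ {b b′} → (T b → T b′) → b ≤ b′
T→T⇒≤ {false}          _ = ≤-minimum _
T→T⇒≤ {true} {true}    _ = b≤b
T→T⇒≤ {true} {false} imp = ⊥-elim (imp tt)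

lookup-extensional : ∀ {A : Set} {k} {u v : Vec.Vec A k} →
                     (∀ l → Vec.lookup u l ≡ Vec.lookup v l) → u ≡ v
lookup-extensional {u = u} {v} u≗v =
  trans (sym (tabulate∘lookup u)) (trans (tabulate-cong u≗v) (tabulate∘lookup v))

-- The digraph 𝔻

module Paths {m n : ℕ} (R : Tuple m n → Bool) where
  open Construction R
  open InteriorClosed

  matches : Fin m → Tuple m n → Fin n → Bool
  matches d a l = isYes (Vec.lookup a l ≟F d)

  mask : Fin m → Tuple m n → List Bool
  mask d a = tabulate (matches d a)

  mask-length : ∀ d a → length (mask d a) ≡ n
  mask-length d a = length-tabulate (matches d a)

  mask-map : ∀ (g : Fin m → Fin m) d a → mask d a ⊑ mask (g d) (Vec.map g a)
  mask-map g d a = tabulate⁺ λ l → T→T⇒≤ λ t →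
    fromWitness (trans (lookup-map l g a) (cong g (toWitness t)))

  mask⊑⇒ : ∀ {d a d′ c} → mask d a ⊑ mask d′ c → ∀ l → Vec.lookup a l ≡ d → Vec.lookup c l ≡ d′
  mask⊑⇒ s l e = toWitness (≤⇒T→T (tabulate⁻ s l) (fromWitness e))

  shape : Fin m → Tuple m n → List Dir
  shape d a = fwd ∷ segments (mask d a)

  pathQ≡shape : ∀ d a → pathQ d a ≡ shape d a
  pathQ≡shape d a = cong (fwd ∷_) (pieces {n} id)
    where
      pieces : ∀ {k} (ix : Fin k → Fin n) →
               concatMap (piece d a) (tabulate ix) ++ fwd ∷ [] ≡ segments (tabulate (matches d a ∘ ix))
      pieces {zero}  ix = refl
      pieces {suc k} ix with Vec.lookup a (ix F.zero) ≟F d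
      ... | yes _ = cong (fwd ∷_) (pieces (ix ∘ F.suc))
      ... | no  _ = cong (λ W → fwd ∷ bwd ∷ fwd ∷ W) (pieces (ix ∘ F.suc))

  nInt≡ : ∀ d a → nInt d a ≡ length (segments (mask d a))
  nInt≡ d a = suc-injective (cong length (pathQ≡shape d a))

  pathQ⇒shape : ∀ {d a j x} → pathQ d a [ j ]≔ x → shape d a [ j ]≔ x
  pathQ⇒shape {d} {a} {j} {x} = subst (λ W → W [ j ]≔ x) (pathQ≡shape d a)

  at-inner : ∀ d a p {y} (lt : y < nInt d a) → at d a p (suc y) ≡ int d a p (fromℕ< lt)
  at-inner d a p {y} lt with y <? nInt d a
  ... | yes _  = refl
  ... | no y≮ = ⊥-elim (y≮ lt)

  at-end : ∀ d a p → at d a p (length (shape d a)) ≡ rel a p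
  at-end d a p with length (segments (mask d a)) <? nInt d a
  ... | yes lt = ⊥-elim (n≮n _ (subst (_< nInt d a) (sym (nInt≡ d a)) lt))
  ... | no _   = refl

  int-at : ∀ d a p k → int d a p k ≡ at d a p (suc (toℕ k))
  int-at d a p k =
    sym (trans (at-inner d a p (toℕ<n k)) (cong (int d a p) (fromℕ<-toℕ k (toℕ<n k))))

  at≡int : ∀ {d a p i d′ a′ p′ k} → at d a p i ≡ int d′ a′ p′ k →
           d ≡ d′ × a ≡ a′ × i ≡ suc (toℕ k)
  at≡int {i = zero} ()
  at≡int {d} {a} {p} {suc y} e with y <? nInt d a | e
  ... | yes lt | refl = refl , refl , cong suc (sym (toℕ-fromℕ< lt))
  ... | no _   | ()

  at≡dom : ∀ d a p i {d′} → at d a p i ≡ dom d′ → i ≡ 0 × d ≡ d′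
  at≡dom d a p zero refl = refl , refl
  at≡dom d a p (suc y) e with y <? nInt d a | e
  ... | yes _ | ()
  ... | no _  | ()

  at-inner-injective : ∀ d a p {y} → suc y < length (shape d a) → ∀ d′ a′ p′ j →
                       at d′ a′ p′ j ≡ at d a p (suc y) → d′ ≡ d × a′ ≡ a × j ≡ suc y
  at-inner-injective d a p {y} lt _ _ _ _ e =
    let d≡ , a≡ , j≡ = at≡int (trans e (at-inner d a p y<))
    in  d≡ , a≡ , trans j≡ (cong suc (toℕ-fromℕ< y<))
    where y< = subst (y <_) (sym (nInt≡ d a)) (≤-pred lt)

  dom-injective : ∀ {d d′} → dom d ≡ dom d′ → d ≡ d′
  dom-injective refl = refl

  rel-injective : ∀ {c c′} {r : T (R c)} {r′ : T (R c′)} → rel c r ≡ rel c′ r′ → c ≡ c′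
  rel-injective refl = refl

  rel-cong : ∀ {c c′} {r : T (R c)} {r′ : T (R c′)} → c ≡ c′ → rel c r ≡ rel c′ r′
  rel-cong {r = r} {r′} refl = cong (rel _) (T-irrelevant r r′)

  at-transport : ∀ {d d′ a c} {r : T (R c)} {p : T (R a)} i → d′ ≡ d → c ≡ a →
                 at d′ c r (suc (collapse (mask d a) (mask d′ c) i)) ≡ at d a p (suc i)
  at-transport {r = r} {p} i refl refl rewrite T-irrelevant r p =
    cong (at _ _ p ∘ suc) (collapse-diagonal _ i)

  at-walk : ∀ d a p → IsWalk 𝔻 (shape d a) (at d a p)
  at-walk d a p {j} {x} q = edge (subst (λ W → W [ j ]≔ x) (sym (pathQ≡shape d a)) q)
    where
      edge : ∀ {j x} → pathQ d a [ j ]≔ x → Step 𝔻 x (at d a p j) (at d a p (suc j))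
      edge {x = fwd} q with ≔⇒lookup q
      ... | j , refl , e = fwdE d a p j e
      edge {x = bwd} q with ≔⇒lookup q
      ... | j , refl , e = bwdE d a p j e

  on-path : ∀ d a (j : Fin (length (pathQ d a))) {x} → List.lookup (pathQ d a) j ≡ x →
            shape d a [ toℕ j ]≔ x
  on-path d a j e = pathQ⇒shape {d} {a} (subst (pathQ d a [ toℕ j ]≔_) e (lookup⇒≔ (pathQ d a) j))

  data PathEdge (u v : Vtx) : Set where
    forward  : ∀ {d a p j} → shape d a [ j ]≔ fwd →
               u ≡ at d a p j → v ≡ at d a p (suc j) → PathEdge u v
    backward : ∀ {d a p j} → shape d a [ j ]≔ bwd →
               u ≡ at d a p (suc j) → v ≡ at d a p j → PathEdge u v

  edge-view : ∀ {u v} → Edge u v → PathEdge u v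
  edge-view (fwdE d a p j e) = forward  {d = d} {a = a} {p = p} (on-path d a j e) refl refl
  edge-view (bwdE d a p j e) = backward {d = d} {a = a} {p = p} (on-path d a j e) refl refl

  hom-from-paths : ∀ {H} (f : Vtx → Digraph.V H) →
                   (∀ d a p → IsWalk H (shape d a) (f ∘ at d a p)) → IsHom 𝔻 H f
  hom-from-paths f w u v e with edge-view e
  ... | forward  q refl refl = w _ _ _ q
  ... | backward q refl refl = w _ _ _ q

  at-interior-closed : ∀ d a p → InteriorClosed 𝔻 (shape d a) (at d a p)
  at-interior-closed d a p .out-closed lt e with edge-view e
  ... | forward {d′} {a′} {p′} {j} q u≡ v≡ with at-inner-injective d a p lt d′ a′ p′ j (sym u≡)
  ...   | refl , refl , refl with T-irrelevant p′ p
  ...     | refl = inj₁ (q , v≡)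
  at-interior-closed d a p .out-closed lt e | backward {d′} {a′} {p′} {j} q u≡ v≡
    with at-inner-injective d a p lt d′ a′ p′ (suc j) (sym u≡)
  ...   | refl , refl , refl with T-irrelevant p′ p
  ...     | refl = inj₂ (q , v≡)
  at-interior-closed d a p .in-closed lt e with edge-view e
  ... | forward {d′} {a′} {p′} {j} q u≡ v≡ with at-inner-injective d a p lt d′ a′ p′ (suc j) (sym v≡)
  ...   | refl , refl , refl with T-irrelevant p′ p
  ...     | refl = inj₁ (q , u≡)
  at-interior-closed d a p .in-closed lt e | backward {d′} {a′} {p′} {j} q u≡ v≡
    with at-inner-injective d a p lt d′ a′ p′ j (sym v≡)
  ...   | refl , refl , refl with T-irrelevant p′ p
  ...     | refl = inj₂ (q , u≡)

  dom-out : ∀ {d v} → Edge (dom d) v → Σ (Tuple m n) λ c → Σ (T (R c)) λ r → v ≡ at d c r 1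
  dom-out e with edge-view e
  ... | forward {d′} {c} {r} {j} _ u≡ v≡ with at≡dom d′ c r j (sym u≡)
  ...   | refl , refl = c , r , v≡
  dom-out e | backward {d′} {c} {r} {j} _ u≡ _ with at≡dom d′ c r (suc j) (sym u≡)
  ...   | () , _

  path-image-walk : ∀ {H} (f : Vtx → Digraph.V H) {d a p bs′} (ψ : ℕ → Digraph.V H) →
    mask d a ⊑ bs′ → IsWalk H (fwd ∷ segments bs′) ψ →
    f (dom d) ≡ ψ 0 → f (rel a p) ≡ ψ (suc (length (segments bs′))) →
    (∀ k → f (int d a p k) ≡ ψ (suc (collapse (mask d a) bs′ (toℕ k)))) →
    IsWalk H (shape d a) (f ∘ at d a p)
  path-image-walk f {d} {a} {p} {bs′} ψ s w f-dom f-rel f-int =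
    walk-cong agree (walk-cons (w here) (collapse-walk s (walk-tail w)))
    where
      open ≡-Reasoning
      ψ′ : ℕ → _
      ψ′ = ψ ∘ suc ∘ collapse (mask d a) bs′

      agree : ∀ i → i ≤ℕ length (shape d a) → (ψ 0 ◂ ψ′) i ≡ f (at d a p i)
      agree zero _ = sym f-dom
      agree (suc y) le with m≤n⇒m<n∨m≡n (≤-pred le)
      ... | inj₁ lt = begin
        ψ′ y                          ≡⟨ cong ψ′ (sym (toℕ-fromℕ< y<)) ⟩
        ψ′ (toℕ (fromℕ< y<))          ≡⟨ sym (f-int _) ⟩
        f (int d a p (fromℕ< y<))     ≡⟨ cong f (sym (at-inner d a p y<)) ⟩
        f (at d a p (suc y))          ∎
        where y< = subst (y <_) (sym (nInt≡ d a)) lt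
      ... | inj₂ refl = begin
        ψ′ (length (segments (mask d a)))  ≡⟨ cong (ψ ∘ suc) (collapse-end s) ⟩
        ψ (suc (length (segments bs′)))    ≡⟨ sym f-rel ⟩
        f (rel a p)                        ≡⟨ cong f (sym (at-end d a p)) ⟩
        f (at d a p (length (shape d a)))  ∎

  index-bounded : ∀ d a (k : Fin (nInt d a)) → toℕ k ≤ℕ length (segments (mask d a))
  index-bounded d a k = <⇒≤ (subst (toℕ k <_) (nInt≡ d a) (toℕ<n k))

  -- Folding every Q_S onto the directed path Q_{1,…,n} grades 𝔻 by levels.
  level : Vtx → ℕ
  level (dom _)       = 0
  level (rel _ _)     = suc (length (segments (full n)))
  level (int d a _ k) = suc (collapse (mask d a) (full n) (toℕ k))

  mask⊑full : ∀ d a → mask d a ⊑ full n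
  mask⊑full d a = tabulate⁺ (λ _ → ≤-maximum _)

  level-hom : IsHom 𝔻 ℕ⃗ level
  level-hom = hom-from-paths level λ d a p →
    path-image-walk level id (mask⊑full d a) (identity-walk n) refl refl (λ _ → refl)

  level-bounded : ∀ v → level v ≤ℕ suc (length (segments (full n)))
  level-bounded (dom _)       = z≤n
  level-bounded (rel _ _)     = ≤-refl
  level-bounded (int d a _ k) = s≤s (collapse-bounded (mask⊑full d a) (toℕ k) (index-bounded d a k))

  level-zero : ∀ v → level v ≡ 0 → ∃ λ d → v ≡ dom d
  level-zero (dom d) _ = d , refl

  dom-or-tuple : ∀ v → (∃ λ d → v ≡ dom d) ⊎ Σ (Tuple m n) (T ∘ R)
  dom-or-tuple (dom d)       = inj₁ (d , refl)
  dom-or-tuple (rel a p)     = inj₂ (a , p)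
  dom-or-tuple (int _ a p _) = inj₂ (a , p)

  module Induced (g : Fin m → Fin m) (pres : PreservesR R g) where

    h : Vtx → Vtx
    h (dom d)       = dom (g d)
    h (rel a p)     = rel (Vec.map g a) (pres a p)
    h (int d a p k) = at (g d) (Vec.map g a) (pres a p)
                         (suc (collapse (mask d a) (mask (g d) (Vec.map g a)) (toℕ k)))

    h-hom : IsEndo 𝔻 h
    h-hom = hom-from-paths {H = 𝔻} h λ d a p →
      path-image-walk h (at (g d) (Vec.map g a) (pres a p)) (mask-map g d a)
                      (at-walk (g d) (Vec.map g a) (pres a p))
                      refl (sym (at-end (g d) (Vec.map g a) (pres a p))) (λ _ → refl)

-- Endomorphisms of 𝔻

module Endomorphism {m n : ℕ} {R : Tuple m n → Bool}
                    (h : Construction.Vtx R → Construction.Vtx R) (hom : IsEndo (Construction.𝔻 R) h) where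
  open Construction R
  open Paths R

  -- Along a path and its image under h levels differ by level (h (dom d)); as no vertex
  -- lies above R, this constant is 0.
  dom-level : ∀ d b q → level (h (dom d)) ≡ 0
  dom-level d b q = n≤0⇒n≡0 (+-cancelʳ-≤ top (level (h (dom d))) 0 (begin
      level (h (dom d)) + top   ≡⟨ sym parallel ⟩
      level (h (rel b q)) + 0   ≡⟨ +-identityʳ _ ⟩
      level (h (rel b q))       ≤⟨ level-bounded _ ⟩
      top                       ∎))
    where
      open ≤-Reasoning
      top = suc (length (segments (full n)))
      parallel : level (h (rel b q)) + 0 ≡ level (h (dom d)) + top
      parallel = subst (λ v → level (h v) + 0 ≡ level (h (dom d)) + level v) (at-end d b q)
        (walks-parallel (hom-walk level-hom (hom-walk hom (at-walk d b q)))
                        (hom-walk level-hom (at-walk d b q)) _ ≤-refl)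

  dom-image : ∀ d → ∃ λ d′ → h (dom d) ≡ dom d′
  dom-image d = [ id , (λ (b , q) → level-zero _ (dom-level d b q)) ]′ (dom-or-tuple (h (dom d)))

  g : Fin m → Fin m
  g d = proj₁ (dom-image d)

  path-image : ∀ d a p → Σ (Tuple m n) λ c → Σ (T (R c)) λ r →
    mask d a ⊑ mask (g d) c × h (rel a p) ≡ rel c r ×
    (∀ i → i ≤ℕ length (segments (mask d a)) →
       h (at d a p (suc i)) ≡ at (g d) c r (suc (collapse (mask d a) (mask (g d) c) i)))
  path-image d a p = c , r , s , end , along
    where
      first-edge : Edge (dom (g d)) (h (at d a p 1))
      first-edge = subst (λ u → Edge u (h (at d a p 1))) (proj₂ (dom-image d))
                         (hom (dom d) (at d a p 1) (at-walk d a p here))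
      c = proj₁ (dom-out first-edge)
      r = proj₁ (proj₂ (dom-out first-edge))
      first = proj₂ (proj₂ (dom-out first-edge))
      forced = collapse-forced {bs = mask d a} {mask (g d) c} (trans (mask-length d a) (sym (mask-length (g d) c)))
                 (at-interior-closed (g d) c r) (walk-tail (hom-walk hom (at-walk d a p))) first
      s = proj₁ forced
      along = proj₂ forced
      end : h (rel a p) ≡ rel c r
      end = begin
        h (rel a p)                                   ≡⟨ cong h (sym (at-end d a p)) ⟩
        h (at d a p (length (shape d a)))             ≡⟨ along _ ≤-refl ⟩
        at (g d) c r (suc (collapse (mask d a) (mask (g d) c) (length (segments (mask d a)))))
                                                      ≡⟨ cong (at (g d) c r ∘ suc) (collapse-end s) ⟩
        at (g d) c r (length (shape (g d) c))         ≡⟨ at-end (g d) c r ⟩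
        rel c r                                       ∎
        where open ≡-Reasoning

  rel-or-point : ∀ v → (Σ (Tuple m n) λ c → Σ (T (R c)) λ r → v ≡ rel c r) ⊎ Fin m
  rel-or-point (dom d)       = inj₂ d
  rel-or-point (rel c r)     = inj₁ (c , r , refl)
  rel-or-point (int d _ _ _) = inj₂ d

  rel-image : ∀ a p → Σ (T (R (Vec.map g a))) λ r → h (rel a p) ≡ rel (Vec.map g a) r
  rel-image a p = subst (λ c → Σ (T (R c)) λ r → h (rel a p) ≡ rel c r) c≡ (proj₂ image)
    where
      image : Σ (Tuple m n) λ c → Σ (T (R c)) λ r → h (rel a p) ≡ rel c r
      image = [ id , (λ d → let c , r , _ , e , _ = path-image d a p in c , r , e) ]′
                (rel-or-point (h (rel a p)))

      -- The path from a_l to a forces c_l = g a_l.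
      c≡ : proj₁ image ≡ Vec.map g a
      c≡ = lookup-extensional λ l →
        let c′ , _ , s , e′ , _ = path-image (Vec.lookup a l) a p
        in  trans (cong (λ v → Vec.lookup v l) (rel-injective (trans (sym (proj₂ (proj₂ image))) e′)))
                  (trans (mask⊑⇒ {a = a} {c = c′} s l refl) (sym (lookup-map l g a)))

  g-preserves : PreservesR R g
  g-preserves a p = proj₁ (rel-image a p)

  g≗id⇒h≗id : (∀ x → g x ≡ x) → ∀ v → h v ≡ v
  g≗id⇒h≗id g≗id = h≗id
    where
      map-g≡ : ∀ a → Vec.map g a ≡ a
      map-g≡ a = trans (map-cong g≗id a) (map-id a)

      h≗id : ∀ v → h v ≡ v
      h≗id (dom d) = trans (proj₂ (dom-image d)) (cong dom (g≗id d))
      h≗id (rel a p) = trans (proj₂ (rel-image a p)) (rel-cong (map-g≡ a))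
      h≗id (int d a p k) =
        let c , r , _ , e , along = path-image d a p
            c≡a = trans (rel-injective (trans (sym e) (proj₂ (rel-image a p)))) (map-g≡ a)
        in begin
          h (int d a p k)                     ≡⟨ cong h (int-at d a p k) ⟩
          h (at d a p (suc (toℕ k)))          ≡⟨ along (toℕ k) (index-bounded d a k) ⟩
          at (g d) c r (suc (collapse (mask d a) (mask (g d) c) (toℕ k)))
                                              ≡⟨ at-transport (toℕ k) (g≗id d) c≡a ⟩
          at d a p (suc (toℕ k))              ≡⟨ sym (int-at d a p k) ⟩
          int d a p k                         ∎
        where open ≡-Reasoning

module _ {m n : ℕ} (R : Tuple m n → Bool) where
  open Construction R
  open Paths R

  rigid⇒𝔻-rigid : (∀ g → PreservesR R g → ∀ x → g x ≡ x) → RigidCoreG 𝔻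
  rigid⇒𝔻-rigid rigid h hom = g≗id⇒h≗id (rigid g g-preserves)
    where open Endomorphism h hom

  𝔻-rigid⇒rigid : RigidCoreG 𝔻 → ∀ g → PreservesR R g → ∀ x → g x ≡ x
  𝔻-rigid⇒rigid rigid g pres x = dom-injective (rigid h h-hom (dom x))
    where open Induced g pres

mainTheorem2 : (m n : ℕ) (w : WeightedRelation m n) →
    RigidCoreW w ⇔ RigidCoreG (digraphOf w)
mainTheorem2 m n w = mk⇔ (rigid⇒𝔻-rigid R) (𝔻-rigid⇒rigid R)
  where open WeightedRelation w
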